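{- For every $n\ge 3$, in the edge-distinguishing game (EDGe) played on the triangular book graph $B_n$ (with $\lambda(B_n)$ colors), Player 2 has a winning strategy.
   Context: $B_n=K_2\nabla\overline{K_{n-2}}$: two adjacent spine vertices plus $n-2$ pairwise nonadjacent vertices each adjacent to both spine vertices. For a positive integer $k$ let $[k]=\{1,\dots,k\}$. A $k$-coloring $c:V(G)\to[k]$ induces $c'(\{u,v\})=\{c(u),c(v)\}$ (a multiset); $c$ is edge-distinguishing if $c'$ is injective, and $\lambda(G)$ is the least $k$ admitting such a coloring. A partial coloring on $U\subseteq V(G)$ has partial induced edge coloring on $G[U]$. EDGe on $G$: two players, Player 1 first, alternately color an uncolored vertex with a color from $[\lambda(G)]$; a move is legal iff afterwards the partial induced edge coloring of the colored vertices is injective. The player making the last legal move wins. A winning strategy guarantees a win regardless of the opponent's play. -}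

module Defs where

open import Data.Nat using (ℕ; _<_)
open import Data.Fin using (Fin; toℕ; _≟_)
open import Data.Maybe using (Maybe; just; nothing)
open import Data.Product using (Σ; _×_; _,_)
open import Data.Sum using (_⊎_)
open import Relation.Binary.PropositionalEquality using (_≡_; _≢_)
open import Relation.Nullary using (¬_; yes; no)

record Graph : Set₁ where
  field
    N     : ℕ
    Adj   : Fin N → Fin N → Set
    irrefl : ∀ {u} → ¬ Adj u u
    sym   : ∀ {u v} → Adj u v → Adj v u
open Graph public

SamePair : {A : Set} → A → A → A → A → Set
SamePair a b c d = (a ≡ c × b ≡ d) ⊎ (a ≡ d × b ≡ c)

-- Partial k-coloring: uncolored vertices map to nothing. Color i : Fin k stands for i+1 ∈ [k].
PartialColoring : Graph → ℕ → Set
PartialColoring G k = Fin (N G) → Maybe (Fin k)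

-- The partial induced edge coloring on G[U] (U = colored vertices) is injective.
InjectiveInduced : (G : Graph) {k : ℕ} → PartialColoring G k → Set
InjectiveInduced G c =
  ∀ u v x y a b a' b' →
  Adj G u v → Adj G x y →
  c u ≡ just a → c v ≡ just b → c x ≡ just a' → c y ≡ just b' →
  SamePair a b a' b' → SamePair u v x y

EdgeDistinguishing : (G : Graph) {k : ℕ} → (Fin (N G) → Fin k) → Set
EdgeDistinguishing G c = InjectiveInduced G (λ v → just (c v))

IsLambda : Graph → ℕ → Set
IsLambda G k =
  Σ (Fin (N G) → Fin k) (EdgeDistinguishing G) ×
  (∀ k' → k' < k → ¬ Σ (Fin (N G) → Fin k') (EdgeDistinguishing G))

update : (G : Graph) {k : ℕ} → PartialColoring G k → Fin (N G) → Fin k → PartialColoring G k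
update G c v i w with w ≟ v
... | yes _ = just i
... | no  _ = c w

-- EDGe with k colors, normal play (last legal move wins).
-- Wins c   : the player to move at position c has a winning strategy.
-- Loses c  : the player NOT to move at c has a winning strategy
--            (every legal move leads to a position where the mover-to-be wins).
-- Since every move colors a new vertex the game is finite, and these
-- inductive definitions are exactly (well-founded) winning strategies.
data Wins  (G : Graph) (k : ℕ) (c : PartialColoring G k) : Set
data Loses (G : Graph) (k : ℕ) (c : PartialColoring G k) : Set

data Wins G k c where
  move : (v : Fin (N G)) (i : Fin k) → c v ≡ nothing →
         InjectiveInduced G (update G c v i) →
         Loses G k (update G c v i) → Wins G k c

data Loses G k c where
  respond : (∀ (v : Fin (N G)) (i : Fin k) → c v ≡ nothing →
             InjectiveInduced G (update G c v i) →
             Wins G k (update G c v i)) → Loses G k c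

Player2Wins : Graph → ℕ → Set
Player2Wins G k = Loses G k (λ _ → nothing)

-- Triangular book B_n = K_2 ∇ complement(K_{n-2}) on vertices Fin n;
-- vertices 0 and 1 are the spine.
BookAdj : (n : ℕ) → Fin n → Fin n → Set
BookAdj n u v = u ≢ v × (toℕ u < 2 ⊎ toℕ v < 2)

Book : ℕ → Graph
Book n = record
  { N = n
  ; Adj = BookAdj n
  ; irrefl = λ { (ne , _) → ne Relation.Binary.PropositionalEquality.refl }
  ; sym = λ { (ne , Data.Sum.inj₁ p) → (λ e → ne (Relation.Binary.PropositionalEquality.sym e)) , Data.Sum.inj₂ p
            ; (ne , Data.Sum.inj₂ p) → (λ e → ne (Relation.Binary.PropositionalEquality.sym e)) , Data.Sum.inj₁ p } }

{-# OPTIONS --safe #-}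
-- Any edge-distinguishing colouring of B_n is injective on vertices (two vertices of
-- B_n always have a common neighbour), so λ(B_n) ≥ n and a fresh colour is always
-- available.  Player 2 answers the first move by a symmetric one.  If Player 1 colours
-- a spine vertex, Player 2 gives the other spine vertex the same colour: every page
-- would then see two equal edges, so the game is over.  If Player 1 colours a page
-- with colour a, then either Player 2 colours a spine vertex with a (odd number of
-- pages), after which the second spine vertex is dead and exactly the remaining pages
-- get coloured, with distinct colours; or Player 2 colours a second page with a (even
-- number of pages), after which both spine vertices are dead and again exactly the
-- remaining pages get coloured.  Either way an even number of moves is left.
module Submission where

open import Defs
open import Data.Nat using (ℕ; zero; suc; _+_; _≤_; _<_; z≤n; s≤s)
open import Data.Nat.Properties using (+-suc; 1+n≰n; ≤-trans) renaming (suc-injective to ℕ-suc-injective)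
open import Data.Fin using (Fin; zero; suc; _≟_; punchIn; punchOut; fromℕ<)
open import Data.Fin.Properties using (suc-injective; punchInᵢ≢i; punchOut-injective; injective⇒≤; any?; all?; ¬∀⟶∃¬)
open import Data.Maybe using (Maybe; just; nothing)
open import Data.Maybe.Properties using (just-injective; ≡-dec)
open import Data.Product using (Σ; ∃; ∃₂; _×_; _,_; proj₁; proj₂)
open import Data.Sum using (_⊎_; inj₁; inj₂)
open import Data.Empty using (⊥; ⊥-elim)
open import Function using (_∘_)
open import Relation.Nullary using (¬_; Dec; yes; no)
open import Relation.Binary.PropositionalEquality as ≡ using (_≡_; _≢_; refl; trans; cong; subst)

SamePair-sym : ∀ {A : Set} {a b c d : A} → SamePair a b c d → SamePair c d a b
SamePair-sym (inj₁ (refl , refl)) = inj₁ (refl , refl)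
SamePair-sym (inj₂ (refl , refl)) = inj₂ (refl , refl)

SamePair-trans : ∀ {A : Set} {a b c d e f : A} → SamePair a b c d → SamePair c d e f → SamePair a b e f
SamePair-trans (inj₁ (refl , refl)) q = q
SamePair-trans (inj₂ (refl , refl)) (inj₁ (refl , refl)) = inj₂ (refl , refl)
SamePair-trans (inj₂ (refl , refl)) (inj₂ (refl , refl)) = inj₁ (refl , refl)

SamePair-cancelˡ : ∀ {A : Set} {x a b : A} → SamePair x a x b → a ≡ b
SamePair-cancelˡ (inj₁ (_ , a≡b)) = a≡b
SamePair-cancelˡ (inj₂ (x≡b , a≡x)) = trans a≡x x≡b

clash : ∀ {A : Set} {x : Maybe A} {a} → x ≡ just a → x ≡ nothing → ⊥
clash refl ()

coloured≢free : ∀ {A B : Set} (c : A → Maybe B) {v w a} → c v ≡ just a → c w ≡ nothing → v ≢ w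
coloured≢free c cv cw refl = clash cv cw

#nothing : ∀ {A : Set} {n} → (Fin n → Maybe A) → ℕ
#nothing {n = zero} f = 0
#nothing {n = suc n} f with f zero
... | nothing = suc (#nothing (f ∘ suc))
... | just _ = #nothing (f ∘ suc)

module _ {A : Set} where

  #nothing-const : ∀ n → #nothing {A} {n} (λ _ → nothing) ≡ n
  #nothing-const zero = refl
  #nothing-const (suc n) = cong suc (#nothing-const n)

  #nothing-cong : ∀ {n} {f g : Fin n → Maybe A} → (∀ w → f w ≡ g w) → #nothing f ≡ #nothing g
  #nothing-cong {zero} f≗g = refl
  #nothing-cong {suc n} {f} {g} f≗g rewrite f≗g zero with g zero
  ... | nothing = cong suc (#nothing-cong (f≗g ∘ suc))
  ... | just _ = #nothing-cong (f≗g ∘ suc)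

  #nothing-fill : ∀ {n} {f g : Fin n → Maybe A} {v a} → f v ≡ nothing → g v ≡ just a →
                  (∀ {w} → w ≢ v → g w ≡ f w) → #nothing f ≡ suc (#nothing g)
  #nothing-fill {suc n} {f} {g} {zero} fv gv others rewrite fv | gv =
    cong suc (#nothing-cong (λ w → ≡.sym (others {suc w} λ ())))
  #nothing-fill {suc n} {f} {g} {suc v} fv gv others rewrite others {zero} (λ ()) with f zero
  ... | nothing = cong suc (#nothing-fill fv gv (λ w≢v → others (w≢v ∘ suc-injective)))
  ... | just _ = #nothing-fill fv gv (λ w≢v → others (w≢v ∘ suc-injective))

  #nothing-free : ∀ {n} {f : Fin n → Maybe A} {v} → f v ≡ nothing → #nothing f ≢ 0
  #nothing-free {suc n} {f} {zero} fv rewrite fv = λ ()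
  #nothing-free {suc n} {f} {suc v} fv with f zero
  ... | nothing = λ ()
  ... | just _ = #nothing-free {f = f ∘ suc} fv

  #nothing-suc : ∀ {n} {f : Fin n → Maybe A} {j} → #nothing f ≡ suc j → ∃ λ v → f v ≡ nothing
  #nothing-suc {suc n} {f} count with f zero in f0
  ... | nothing = zero , f0
  ... | just _ = let v , fv = #nothing-suc count in suc v , fv

colourUsed? : ∀ {n k} (c : Fin n → Maybe (Fin k)) y → Dec (∃ λ w → c w ≡ just y)
colourUsed? c y = any? (λ w → ≡-dec _≟_ (c w) (just y))

unusedColour : ∀ {n k} → suc n ≤ k → (c : Fin (suc n) → Maybe (Fin k)) {v : Fin (suc n)} →
               c v ≡ nothing → ∃ λ y → ∀ w → c w ≢ just y
unusedColour {n} {k} enough c {v} free with all? (colourUsed? c)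
... | no notAllUsed = let y , unused = ¬∀⟶∃¬ k _ (colourUsed? c) notAllUsed in y , λ w cw → unused (w , cw)
... | yes allUsed = ⊥-elim (1+n≰n (≤-trans enough (injective⇒≤ holder-injective)))
  where
    holder≢v : ∀ y → v ≢ proj₁ (allUsed y)
    holder≢v y v≡holder = clash (subst (λ w → c w ≡ just y) (≡.sym v≡holder) (proj₂ (allUsed y))) free
    holder-injective : ∀ {y y′} → punchOut (holder≢v y) ≡ punchOut (holder≢v y′) → y ≡ y′
    holder-injective {y} {y′} same = just-injective (begin
      just y                  ≡⟨ ≡.sym (proj₂ (allUsed y)) ⟩
      c (proj₁ (allUsed y))   ≡⟨ cong c (punchOut-injective (holder≢v y) (holder≢v y′) same) ⟩
      c (proj₁ (allUsed y′))  ≡⟨ proj₂ (allUsed y′) ⟩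
      just y′                 ∎)
      where open ≡.≡-Reasoning

even-or-odd : ∀ m → ∃ λ t → m ≡ t + t ⊎ m ≡ suc (t + t)
even-or-odd zero = 0 , inj₁ refl
even-or-odd (suc m) with even-or-odd m
... | t , inj₁ m≡2t = t , inj₂ (cong suc m≡2t)
... | t , inj₂ m≡2t+1 = suc t , inj₁ (cong suc (trans m≡2t+1 (≡.sym (+-suc t t))))

anotherElement : ∀ {m} → 0 < m → (p : Fin (suc m)) → ∃ λ q → q ≢ p
anotherElement 0<m p = punchIn p (fromℕ< 0<m) , punchInᵢ≢i p _

Legal : (G : Graph) {k : ℕ} → PartialColoring G k → Fin (N G) → Fin k → Set
Legal G c v i = c v ≡ nothing × InjectiveInduced G (update G c v i)

module Game (G : Graph) (k : ℕ) where

  blank : PartialColoring G k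
  blank _ = nothing

  update-same : ∀ (c : PartialColoring G k) v i → update G c v i v ≡ just i
  update-same c v i with v ≟ v
  ... | yes _ = refl
  ... | no v≢v = ⊥-elim (v≢v refl)

  update-other : ∀ (c : PartialColoring G k) {v} i {w} → w ≢ v → update G c v i w ≡ c w
  update-other c {v} i {w} w≢v with w ≟ v
  ... | yes w≡v = ⊥-elim (w≢v w≡v)
  ... | no _ = refl

  update-colour⁻¹ : ∀ {c : PartialColoring G k} {v i} w {a} → update G c v i w ≡ just a →
                    (w ≡ v × a ≡ i) ⊎ c w ≡ just a
  update-colour⁻¹ {v = v} w cw with w ≟ v | cw
  ... | yes w≡v | refl = inj₁ (w≡v , refl)
  ... | no _ | cw′ = inj₂ cw′

  update-blank : ∀ {v i} w {a} → update G blank v i w ≡ just a → w ≡ v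
  update-blank w cw with update-colour⁻¹ w cw
  ... | inj₁ (w≡v , _) = w≡v
  ... | inj₂ ()

  adjacent⇒≢ : ∀ {u v} → Adj G u v → u ≢ v
  adjacent⇒≢ uv refl = irrefl G uv

  play : ∀ {c v i} → Legal G c v i → Loses G k (update G c v i) → Wins G k c
  play (free , injective) = move _ _ free injective

  answer : ∀ {c} → (∀ {v i} → Legal G c v i → Wins G k (update G c v i)) → Loses G k c
  answer reply = respond λ v i free injective → reply (free , injective)

  stuck⇒loses : ∀ {c} → (∀ {v i} → ¬ Legal G c v i) → Loses G k c
  stuck⇒loses stuck = answer (⊥-elim ∘ stuck)

  neighbours-distinct : ∀ {c : PartialColoring G k} {s u v x a} → InjectiveInduced G c →
                        Adj G s u → Adj G s v → c s ≡ just x → c u ≡ just a → c v ≡ just a → u ≡ v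
  neighbours-distinct injective su sv cs cu cv =
    SamePair-cancelˡ (injective _ _ _ _ _ _ _ _ su sv cs cu cs cv (inj₁ (refl , refl)))

  twins-block : ∀ {c : PartialColoring G k} {s u v a i} → Adj G s u → Adj G s v → u ≢ v →
                c u ≡ just a → c v ≡ just a → ¬ Legal G c s i
  twins-block {c} {s} {i = i} su sv u≢v cu cv (_ , injective) =
    u≢v (neighbours-distinct injective su sv (update-same c s i) (kept su cu) (kept sv cv))
    where
      kept : ∀ {w a} → Adj G s w → c w ≡ just a → update G c s i w ≡ just a
      kept sw cw = trans (update-other c i (adjacent⇒≢ sw ∘ ≡.sym)) cw

  edgeless-injective : ∀ {c : PartialColoring G k} →
                       (∀ {u v a b} → Adj G u v → c u ≡ just a → c v ≡ just b → ⊥) → InjectiveInduced G c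
  edgeless-injective noEdge _ _ _ _ _ _ _ _ uv _ cu cv _ _ _ = ⊥-elim (noEdge uv cu cv)

  twoVertices-injective : ∀ s t i j → InjectiveInduced G (update G (update G blank s i) t j)
  twoVertices-injective s t i j _ _ _ _ _ _ _ _ uv xy cu cv cx cy _ =
    SamePair-trans (onEdge uv cu cv) (SamePair-sym (onEdge xy cx cy))
    where
      support : ∀ {w a} → update G (update G blank s i) t j w ≡ just a → w ≡ t ⊎ w ≡ s
      support {w} cw with update-colour⁻¹ w cw
      ... | inj₁ (w≡t , _) = inj₁ w≡t
      ... | inj₂ cw′ = inj₂ (update-blank w cw′)
      onEdge : ∀ {u v a b} → Adj G u v → update G (update G blank s i) t j u ≡ just a →
               update G (update G blank s i) t j v ≡ just b → SamePair u v t s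
      onEdge {u} {v} uv cu cv with support {u} cu | support {v} cv
      ... | inj₁ refl | inj₁ refl = ⊥-elim (irrefl G uv)
      ... | inj₁ refl | inj₂ refl = inj₁ (refl , refl)
      ... | inj₂ refl | inj₁ refl = inj₂ (refl , refl)
      ... | inj₂ refl | inj₂ refl = ⊥-elim (irrefl G uv)

  star-injective : ∀ {c : PartialColoring G k} {s x} → c s ≡ just x →
    (∀ {u v a b} → Adj G u v → c u ≡ just a → c v ≡ just b → u ≡ s ⊎ v ≡ s) →
    (∀ {u v a} → Adj G s u → Adj G s v → c u ≡ just a → c v ≡ just a → u ≡ v) →
    InjectiveInduced G c
  star-injective {c} {s} {x} cs through distinct _ _ _ _ _ _ _ _ uv u′v′ cu cv cu′ cv′ same
    with spoke uv cu cv | spoke u′v′ cu′ cv′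
    where
      Spoke : Fin (N G) → Fin (N G) → Fin k → Fin k → Set
      Spoke u v a b = Σ (Fin (N G)) λ w → Σ (Fin k) λ y →
                      Adj G s w × c w ≡ just y × SamePair u v s w × SamePair a b x y
      spoke : ∀ {u v a b} → Adj G u v → c u ≡ just a → c v ≡ just b → Spoke u v a b
      spoke uv cu cv with through uv cu cv
      ... | inj₁ refl = _ , _ , uv , cv , inj₁ (refl , refl) , inj₁ (just-injective (trans (≡.sym cu) cs) , refl)
      ... | inj₂ refl = _ , _ , sym G uv , cu , inj₂ (refl , refl) , inj₂ (refl , just-injective (trans (≡.sym cv) cs))
  ... | w , y , sw , cw , uv≈sw , ab≈xy | w′ , y′ , sw′ , cw′ , u′v′≈sw′ , a′b′≈xy′
    with SamePair-cancelˡ (SamePair-trans (SamePair-sym ab≈xy) (SamePair-trans same a′b′≈xy′))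
  ... | refl with distinct sw sw′ cw cw′
  ... | refl = SamePair-trans uv≈sw (SamePair-sym u′v′≈sw′)

module FixedLength {G : Graph} {k : ℕ} (Remaining : ℕ → PartialColoring G k → Set)
  (stuck : ∀ {c v i} → Remaining 0 c → ¬ Legal G c v i)
  (available : ∀ {j c} → Remaining (suc j) c → ∃₂ (Legal G c))
  (step : ∀ {j c v i} → Remaining (suc j) c → Legal G c v i → Remaining j (update G c v i))
  where

  open Game G k

  mutual
    loses-even : ∀ t {c} → Remaining (t + t) c → Loses G k c
    loses-even zero r = stuck⇒loses (stuck r)
    loses-even (suc t) {c} r = answer (wins-odd t ∘ step (subst (λ j → Remaining j c) (cong suc (+-suc t t)) r))

    wins-odd : ∀ t {c} → Remaining (suc (t + t)) c → Wins G k c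
    wins-odd t r = let _ , _ , legal = available r in play legal (loses-even t (step r legal))

pattern spine₀ = zero
pattern spine₁ = suc zero
pattern page p = suc (suc p)

-- B (3 + m) has spine vertices 0 and 1 and the m + 1 pages 2, …, m + 2.
module BookGame (m k : ℕ) where

  B : Graph
  B = Book (3 + m)

  Colouring : Set
  Colouring = PartialColoring B k

  open Game B k

  spine₀~spine₁ : Adj B spine₀ spine₁
  spine₀~spine₁ = (λ ()) , inj₁ (s≤s z≤n)

  spine₁~spine₀ : Adj B spine₁ spine₀
  spine₁~spine₀ = sym B spine₀~spine₁

  spine₀~page : ∀ p → Adj B spine₀ (page p)
  spine₀~page p = (λ ()) , inj₁ (s≤s z≤n)

  spine₁~page : ∀ p → Adj B spine₁ (page p)
  spine₁~page p = (λ ()) , inj₁ (s≤s (s≤s z≤n))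

  pages-nonadjacent : ∀ {p q} → ¬ Adj B (page p) (page q)
  pages-nonadjacent (_ , inj₁ (s≤s (s≤s ())))
  pages-nonadjacent (_ , inj₂ (s≤s (s≤s ())))

  page-injective : ∀ {p q : Fin (suc m)} → page p ≡ page q → p ≡ q
  page-injective = suc-injective ∘ suc-injective

  commonNeighbour : ∀ {u v} → u ≢ v → ∃ λ w → Adj B w u × Adj B w v
  commonNeighbour {spine₀} {spine₀} u≢v = ⊥-elim (u≢v refl)
  commonNeighbour {spine₀} {spine₁} _ = page zero , sym B (spine₀~page zero) , sym B (spine₁~page zero)
  commonNeighbour {spine₀} {page p} _ = spine₁ , spine₁~spine₀ , spine₁~page p
  commonNeighbour {spine₁} {spine₀} _ = page zero , sym B (spine₁~page zero) , sym B (spine₀~page zero)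
  commonNeighbour {spine₁} {spine₁} u≢v = ⊥-elim (u≢v refl)
  commonNeighbour {spine₁} {page p} _ = spine₀ , spine₀~spine₁ , spine₀~page p
  commonNeighbour {page p} {spine₀} _ = spine₁ , spine₁~page p , spine₁~spine₀
  commonNeighbour {page p} {spine₁} _ = spine₀ , spine₀~page p , spine₀~spine₁
  commonNeighbour {page p} {page q} _ = spine₀ , spine₀~page p , spine₀~page q

  vertices≤λ : IsLambda B k → 3 + m ≤ k
  vertices≤λ ((col , distinguishing) , _) = injective⇒≤ {f = col} col-injective
    where
      col-injective : ∀ {u v} → col u ≡ col v → u ≡ v
      col-injective {u} {v} same with u ≟ v
      ... | yes u≡v = u≡v
      ... | no u≢v = let w , wu , wv = commonNeighbour u≢v in
                     neighbours-distinct distinguishing wu wv refl refl (cong just (≡.sym same))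

  spinesFree-injective : ∀ {c : Colouring} → c spine₀ ≡ nothing → c spine₁ ≡ nothing → InjectiveInduced B c
  spinesFree-injective {c} free₀ free₁ = edgeless-injective noEdge
    where
      noEdge : ∀ {u v a b} → Adj B u v → c u ≡ just a → c v ≡ just b → ⊥
      noEdge {spine₀} _ cu _ = clash cu free₀
      noEdge {spine₁} _ cu _ = clash cu free₁
      noEdge {page _} {spine₀} _ _ cv = clash cv free₀
      noEdge {page _} {spine₁} _ _ cv = clash cv free₁
      noEdge {page _} {page _} uv _ _ = pages-nonadjacent uv

  monochromeSpine-stuck : ∀ {c : Colouring} {a} → c spine₀ ≡ just a → c spine₁ ≡ just a →
                          ∀ {v i} → ¬ Legal B c v i
  monochromeSpine-stuck c₀ c₁ {spine₀} (free , _) = clash c₀ free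
  monochromeSpine-stuck c₀ c₁ {spine₁} (free , _) = clash c₁ free
  monochromeSpine-stuck c₀ c₁ {page r} =
    twins-block (sym B (spine₀~page r)) (sym B (spine₁~page r)) (λ ()) c₀ c₁

  #freePages : Colouring → ℕ
  #freePages c = #nothing (λ p → c (page p))

  #freePages-colourPage : ∀ (c : Colouring) r i → c (page r) ≡ nothing →
                          #freePages c ≡ suc (#freePages (update B c (page r) i))
  #freePages-colourPage c r i free =
    #nothing-fill {f = λ p → c (page p)} {g = λ p → update B c (page r) i (page p)}
                  free (update-same c (page r) i) (λ w≢r → update-other c i (w≢r ∘ page-injective))

  #freePages-onePage : ∀ p i → #freePages (update B blank (page p) i) ≡ m
  #freePages-onePage p i =
    ℕ-suc-injective (trans (≡.sym (#freePages-colourPage blank p i refl)) (#nothing-const {Fin k} (suc m)))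

  module PageGame (Inv : Colouring → Set)
    (spine₀-illegal : ∀ {c i} → Inv c → ¬ Legal B c spine₀ i)
    (spine₁-illegal : ∀ {c i} → Inv c → ¬ Legal B c spine₁ i)
    (preserved : ∀ {c r i} → Inv c → Legal B c (page r) i → Inv (update B c (page r) i))
    (extendable : ∀ {c r} → Inv c → c (page r) ≡ nothing → ∃ λ i → Legal B c (page r) i)
    where

    Remaining : ℕ → Colouring → Set
    Remaining j c = Inv c × #freePages c ≡ j

    stuck : ∀ {c v i} → Remaining 0 c → ¬ Legal B c v i
    stuck {v = spine₀} (inv , _) = spine₀-illegal inv
    stuck {v = spine₁} (inv , _) = spine₁-illegal inv
    stuck {c} {page r} (_ , none) (free , _) = #nothing-free {f = λ p → c (page p)} free none

    available : ∀ {j c} → Remaining (suc j) c → ∃₂ (Legal B c)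
    available {c = c} (inv , count) =
      let r , free = #nothing-suc {f = λ p → c (page p)} count
          i , legal = extendable inv free
      in page r , i , legal

    step : ∀ {j c v i} → Remaining (suc j) c → Legal B c v i → Remaining j (update B c v i)
    step {v = spine₀} (inv , _) legal = ⊥-elim (spine₀-illegal inv legal)
    step {v = spine₁} (inv , _) legal = ⊥-elim (spine₁-illegal inv legal)
    step {v = page r} (inv , count) legal =
      preserved inv legal , ≡.sym (ℕ-suc-injective (trans (≡.sym count) (#freePages-colourPage _ r _ (proj₁ legal))))

    open FixedLength Remaining stuck available step public using (loses-even)

  PagesDistinct : Colouring → Set
  PagesDistinct c = ∀ {p q a} → c (page p) ≡ just a → c (page q) ≡ just a → p ≡ q

  pagesDistinct-update : ∀ {c : Colouring} {r i} → PagesDistinct c →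
                         (∀ {q} → c (page q) ≡ just i → q ≡ r) → PagesDistinct (update B c (page r) i)
  pagesDistinct-update {c} {r} {i} distinct fresh {p} {q} cp cq
    with update-colour⁻¹ {c = c} {page r} {i} (page p) cp | update-colour⁻¹ {c = c} {page r} {i} (page q) cq
  ... | inj₁ (refl , refl) | inj₁ (refl , refl) = refl
  ... | inj₁ (refl , refl) | inj₂ cq′ = ≡.sym (fresh cq′)
  ... | inj₂ cp′ | inj₁ (refl , refl) = fresh cp′
  ... | inj₂ cp′ | inj₂ cq′ = distinct cp′ cq′

  -- Reached when Player 2 copies the colour of a page onto spine₀: spine₁ is dead for good
  -- (its neighbours spine₀ and the echo page share a colour), and the pages still to be
  -- coloured must all get colours distinct from each other and from the coloured pages.
  record Anchored (c : Colouring) : Set where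
    field
      anchor : Fin k
      spine₀-anchor : c spine₀ ≡ just anchor
      spine₁-free : c spine₁ ≡ nothing
      echo : Fin (suc m)
      echo-anchor : c (page echo) ≡ just anchor
      pages-distinct : PagesDistinct c

  anchored-injective : ∀ {c} → Anchored c → InjectiveInduced B c
  anchored-injective {c} anchored = star-injective spine₀-anchor through distinct
    where
      open Anchored anchored
      through : ∀ {u v a b} → Adj B u v → c u ≡ just a → c v ≡ just b → u ≡ spine₀ ⊎ v ≡ spine₀
      through {spine₀} _ _ _ = inj₁ refl
      through {spine₁} _ cu _ = ⊥-elim (clash cu spine₁-free)
      through {page _} {spine₀} _ _ _ = inj₂ refl
      through {page _} {spine₁} _ _ cv = ⊥-elim (clash cv spine₁-free)
      through {page _} {page _} uv _ _ = ⊥-elim (pages-nonadjacent uv)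
      distinct : ∀ {u v a} → Adj B spine₀ u → Adj B spine₀ v → c u ≡ just a → c v ≡ just a → u ≡ v
      distinct {spine₀} su _ _ _ = ⊥-elim (irrefl B su)
      distinct {spine₁} _ _ cu _ = ⊥-elim (clash cu spine₁-free)
      distinct {page _} {spine₀} _ sv _ _ = ⊥-elim (irrefl B sv)
      distinct {page _} {spine₁} _ _ _ cv = ⊥-elim (clash cv spine₁-free)
      distinct {page _} {page _} _ _ cp cq = cong page (pages-distinct cp cq)

  anchored-update : ∀ {c r i} → Anchored c → c (page r) ≡ nothing → (∀ {q} → c (page q) ≡ just i → q ≡ r) →
                    Anchored (update B c (page r) i)
  anchored-update {c} {r} {i} anchored free fresh = record
    { anchor = anchor
    ; spine₀-anchor = spine₀-anchor
    ; spine₁-free = spine₁-free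
    ; echo = echo
    ; echo-anchor = trans (update-other c i (coloured≢free c echo-anchor free)) echo-anchor
    ; pages-distinct = pagesDistinct-update pages-distinct fresh
    }
    where open Anchored anchored

  anchored-spine₀-illegal : ∀ {c i} → Anchored c → ¬ Legal B c spine₀ i
  anchored-spine₀-illegal anchored (free , _) = clash (Anchored.spine₀-anchor anchored) free

  anchored-spine₁-illegal : ∀ {c i} → Anchored c → ¬ Legal B c spine₁ i
  anchored-spine₁-illegal anchored =
    twins-block spine₁~spine₀ (spine₁~page echo) (λ ()) spine₀-anchor echo-anchor
    where open Anchored anchored

  anchored-preserved : ∀ {c r i} → Anchored c → Legal B c (page r) i → Anchored (update B c (page r) i)
  anchored-preserved {c} {r} {i} anchored legal@(free , injective) = anchored-update anchored free fresh
    where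
      fresh : ∀ {q} → c (page q) ≡ just i → q ≡ r
      fresh {q} cq with q ≟ r
      ... | yes q≡r = q≡r
      ... | no q≢r = page-injective
        (neighbours-distinct injective (spine₀~page q) (spine₀~page r) (Anchored.spine₀-anchor anchored)
                             (trans (update-other c i (q≢r ∘ page-injective)) cq) (update-same c (page r) i))

  anchored-extendable : 3 + m ≤ k → ∀ {c r} → Anchored c → c (page r) ≡ nothing → ∃ λ i → Legal B c (page r) i
  anchored-extendable enough {c} anchored free =
    let y , unused = unusedColour enough c free
    in y , free , anchored-injective (anchored-update anchored free (λ {q} cq → ⊥-elim (unused (page q) cq)))

  module AnchoredGame (enough : 3 + m ≤ k) =
    PageGame Anchored anchored-spine₀-illegal anchored-spine₁-illegal anchored-preserved (anchored-extendable enough)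

  -- Reached when Player 2 copies the colour of a page onto a second page: the twins kill
  -- both spine vertices, so no edge is ever coloured and every page move is legal.
  record Blocked (c : Colouring) : Set where
    field
      spine₀-free : c spine₀ ≡ nothing
      spine₁-free : c spine₁ ≡ nothing
      twin twin′ : Fin (suc m)
      twins-differ : twin ≢ twin′
      twin-colour : Fin k
      twin-coloured : c (page twin) ≡ just twin-colour
      twin′-coloured : c (page twin′) ≡ just twin-colour

  blocked-update : ∀ {c r i} → Blocked c → c (page r) ≡ nothing → Blocked (update B c (page r) i)
  blocked-update {c} {r} {i} blocked free = record
    { spine₀-free = spine₀-free
    ; spine₁-free = spine₁-free
    ; twin = twin
    ; twin′ = twin′
    ; twins-differ = twins-differ
    ; twin-colour = twin-colour
    ; twin-coloured = trans (update-other c i (coloured≢free c twin-coloured free)) twin-coloured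
    ; twin′-coloured = trans (update-other c i (coloured≢free c twin′-coloured free)) twin′-coloured
    }
    where open Blocked blocked

  blocked-injective : ∀ {c} → Blocked c → InjectiveInduced B c
  blocked-injective blocked = spinesFree-injective spine₀-free spine₁-free
    where open Blocked blocked

  blocked-spine-illegal : ∀ {c s i} → Blocked c → (∀ p → Adj B s (page p)) → ¬ Legal B c s i
  blocked-spine-illegal blocked s~page =
    twins-block (s~page twin) (s~page twin′) (twins-differ ∘ page-injective) twin-coloured twin′-coloured
    where open Blocked blocked

  blocked-extendable : ∀ {c r} → Blocked c → c (page r) ≡ nothing → ∃ λ i → Legal B c (page r) i
  blocked-extendable blocked free =
    Blocked.twin-colour blocked , free , blocked-injective (blocked-update blocked free)

  module BlockedGame =
    PageGame Blocked (λ blocked → blocked-spine-illegal blocked spine₀~page)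
                     (λ blocked → blocked-spine-illegal blocked spine₁~page)
                     (λ blocked legal → blocked-update blocked (proj₁ legal))
                     blocked-extendable

  oddPages-reply : 3 + m ≤ k → ∀ t p i → m ≡ t + t → Wins B k (update B blank (page p) i)
  oddPages-reply enough t p i m≡2t =
    play (refl , twoVertices-injective (page p) spine₀ i i)
         (AnchoredGame.loses-even enough t (anchored , trans (#freePages-onePage p i) m≡2t))
    where
      only-p : ∀ {q a} → update B blank (page p) i (page q) ≡ just a → q ≡ p
      only-p {q} cq = page-injective (update-blank {v = page p} {i} (page q) cq)
      anchored : Anchored (update B (update B blank (page p) i) spine₀ i)
      anchored = record
        { anchor = i
        ; spine₀-anchor = refl
        ; spine₁-free = refl
        ; echo = p
        ; echo-anchor = update-same blank (page p) i
        ; pages-distinct = λ cq cq′ → trans (only-p cq) (≡.sym (only-p cq′))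
        }

  evenPages-reply : ∀ t p i → m ≡ suc (t + t) → Wins B k (update B blank (page p) i)
  evenPages-reply t p i m≡2t+1 =
    play (free , twoVertices-injective (page p) (page q) i i)
         (BlockedGame.loses-even t (blocked , count))
    where
      another : ∃ λ q → q ≢ p
      another = anotherElement (subst (0 <_) (≡.sym m≡2t+1) (s≤s z≤n)) p
      q : Fin (suc m)
      q = proj₁ another
      page-q≢page-p : page q ≢ page p
      page-q≢page-p = proj₂ another ∘ page-injective
      free : update B blank (page p) i (page q) ≡ nothing
      free = update-other blank i page-q≢page-p
      blocked : Blocked (update B (update B blank (page p) i) (page q) i)
      blocked = record
        { spine₀-free = refl
        ; spine₁-free = refl
        ; twin = p
        ; twin′ = q
        ; twins-differ = page-q≢page-p ∘ cong page ∘ ≡.sym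
        ; twin-colour = i
        ; twin-coloured = trans (update-other _ i (page-q≢page-p ∘ ≡.sym)) (update-same blank (page p) i)
        ; twin′-coloured = update-same _ (page q) i
        }
      count : #freePages (update B (update B blank (page p) i) (page q) i) ≡ t + t
      count = ℕ-suc-injective
        (trans (≡.sym (#freePages-colourPage _ q i free)) (trans (#freePages-onePage p i) m≡2t+1))

  player2Wins : 3 + m ≤ k → Loses B k blank
  player2Wins enough = answer reply
    where
      reply : ∀ {v i} → Legal B blank v i → Wins B k (update B blank v i)
      reply {spine₀} {i} _ =
        play (refl , twoVertices-injective spine₀ spine₁ i i) (stuck⇒loses (monochromeSpine-stuck refl refl))
      reply {spine₁} {i} _ =
        play (refl , twoVertices-injective spine₁ spine₀ i i) (stuck⇒loses (monochromeSpine-stuck refl refl))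
      reply {page p} {i} _ with even-or-odd m
      ... | t , inj₁ m≡2t = oddPages-reply enough t p i m≡2t
      ... | t , inj₂ m≡2t+1 = evenPages-reply t p i m≡2t+1

theorem3p7 : ∀ (n : ℕ) → 3 ≤ n → ∀ (k : ℕ) → IsLambda (Book n) k → Player2Wins (Book n) k
theorem3p7 (suc (suc (suc m))) (s≤s (s≤s (s≤s _))) k isLambda =
  BookGame.player2Wins m k (BookGame.vertices≤λ m k isLambda)
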